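{- Let $D$ be the derivation of $\mathbb{Q}[x,y]$ determined by $D(x)=x+xy$ and $D(y)=y+xy$, and for $n\ge 0$ write $D^n(x)=\sum_{i\ge 1,j\ge 0}a_{n,i,j}x^iy^j$. Then for all $n,i,j\ge 1$, $a_{n,i,j}$ is the number of cyclically ordered partitions of $\{1,\dots,n+1\}$ with $i+j$ blocks whose list of openers contains exactly $i-1$ descents.
   Context: A derivation is a linear map satisfying $D(fg)=D(f)g+fD(g)$. A cyclically ordered partition of $\{1,\dots,m\}$ is a set partition of $\{1,\dots,m\}$ whose blocks are endowed with a cyclic order; it is represented canonically as a list of blocks in which the first block contains $1$ (the other blocks following in the cyclic order) and each block is an increasing list. The opener of a block is its least element; the list of openers is the list of openers of the blocks in canonical order (e.g. $(1)(3)(2)$ has list of openers $132$). A descent of a list $w_1\cdots w_m$ is a position $r$ with $w_r>w_{r+1}$. -}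

module Defs where

open import Data.Nat using (ℕ; zero; suc; _+_; _∸_; _<_; _≤_)
open import Data.Nat.Properties using (_<?_)
open import Data.Rational using (ℚ; 0ℚ; 1ℚ) renaming (_+_ to _+ℚ_; _*_ to _*ℚ_)
open import Data.List using (List; []; _∷_; length; concat; map; upTo; foldr)
open import Data.List.Relation.Unary.All using (All)
open import Data.List.Relation.Unary.Linked using (Linked)
open import Data.List.Membership.Propositional using (_∈_)
open import Data.List.Relation.Binary.Permutation.Propositional using (_↭_)
open import Data.Product using (_×_)
open import Relation.Nullary using (yes; no)
open import Relation.Binary.PropositionalEquality using (_≡_)

-- Polynomials of ℚ[x,y], presented as formal expressions; their
-- meaning is the coefficient function  coeff e i j  = coefficient of x^i y^j.

data Poly : Set where
  con  : ℚ → Poly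
  X    : Poly
  Y    : Poly
  _⊕_  : Poly → Poly → Poly
  _⊗_  : Poly → Poly → Poly

sumTo : ℕ → (ℕ → ℚ) → ℚ
sumTo n f = foldr _+ℚ_ 0ℚ (map f (upTo (suc n)))

coeff : Poly → ℕ → ℕ → ℚ
coeff (con q) zero zero = q
coeff (con q) _    _    = 0ℚ
coeff X (suc zero) zero = 1ℚ
coeff X _ _ = 0ℚ
coeff Y zero (suc zero) = 1ℚ
coeff Y _ _ = 0ℚ
coeff (p ⊕ q) i j = coeff p i j +ℚ coeff q i j
coeff (p ⊗ q) i j =
  sumTo i (λ a → sumTo j (λ b → coeff p a b *ℚ coeff q (i ∸ a) (j ∸ b)))

D : Poly → Poly
D (con q) = con 0ℚ
D X       = X ⊕ (X ⊗ Y)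
D Y       = Y ⊕ (X ⊗ Y)
D (p ⊕ q) = D p ⊕ D q
D (p ⊗ q) = (D p ⊗ q) ⊕ (p ⊗ D q)

iterD : ℕ → Poly → Poly
iterD zero    p = p
iterD (suc n) p = D (iterD n p)

-- Cyclically ordered partitions, in canonical form: a list of blocks,
-- each block a nonempty strictly increasing list, the blocks together
-- being a permutation of 1..m, and the first block containing 1.

data NonEmpty : List ℕ → Set where
  nonEmpty : ∀ {h t} → NonEmpty (h ∷ t)

oneTo : ℕ → List ℕ
oneTo m = map suc (upTo m)

FirstContainsOne : List (List ℕ) → Set
FirstContainsOne []      = 0 ≡ 1
FirstContainsOne (b ∷ _) = 1 ∈ b

CycOrdPartition : ℕ → List (List ℕ) → Set
CycOrdPartition m π =
  All NonEmpty π × All (Linked _<_) π × (concat π ↭ oneTo m) × FirstContainsOne π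

-- opener of a block = its least (= first, since blocks are increasing) element
opener : List ℕ → ℕ
opener []      = 0
opener (h ∷ _) = h

openers : List (List ℕ) → List ℕ
openers = map opener

descentsFrom : ℕ → List ℕ → ℕ
descentsFrom a []      = 0
descentsFrom a (b ∷ w) with b <? a
... | yes _ = suc (descentsFrom b w)
... | no  _ = descentsFrom b w

descents : List ℕ → ℕ
descents []      = 0
descents (a ∷ w) = descentsFrom a w

-- Give a cyclically ordered partition with k blocks whose openers have d descents the
-- weight x^(d + 1) y^(k − d − 1).  Every partition of {1, …, m + 1} arises exactly once from a
-- partition of {1, …, m} by inserting m + 1, either at the end of one of its k blocks (k ways,
-- k and d unchanged) or as a new singleton block right after one of them; in the latter case d
-- stays the same for d + 1 of the k positions and grows by one for the other k − 1 − d.  Since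
-- D = x (1 + y) ∂/∂x + y (1 + x) ∂/∂y maps x^a y^b to (a + b) x^a y^b + a x^a y^(b + 1)
-- + b x^(a + 1) y^b, the weights of the extensions of a partition add up to D of its weight,
-- and by induction D^n(x) is the sum of the weights of the partitions of {1, …, n + 1}.
-- Coefficients are computed in ℕ and transported to ℚ.

module Submission where

open import Defs
open import Data.Nat using (ℕ; zero; suc; _+_; _*_; _∸_; _<_; _≤_; z≤n; s≤s)
import Data.Nat.Properties as ℕP
open import Data.Nat.Properties using (_<?_)
open import Data.Nat.ListAction using (sum)
open import Data.Nat.ListAction.Properties using (sum-++)
open import Data.Nat.Tactic.RingSolver using (solve-∀)
import Data.Nat.Coprimality as Coprime
open import Data.Integer as ℤ using (+_)
import Data.Integer.Properties as ℤP
open import Data.Rational as ℚ using (ℚ; _/_; toℚᵘ; 0ℚ)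
import Data.Rational.Properties as ℚP
import Data.Rational.Unnormalised as ℚᵘ
import Data.Rational.Unnormalised.Properties as ℚᵘP
open import Data.List using (List; []; _∷_; _++_; [_]; map; foldr; concat; concatMap; length; applyUpTo; upTo; head; filter)
import Data.List.Properties as LP
open import Data.List.Relation.Unary.All as All using (All; []; _∷_)
import Data.List.Relation.Unary.All.Properties as AllP
open import Data.List.Relation.Unary.Any using (here; there)
open import Data.List.Relation.Unary.Linked using (Linked; []; [-]; _∷_)
open import Data.List.Relation.Unary.AllPairs using ([]; _∷_)
open import Data.List.Relation.Unary.Unique.Propositional using (Unique)
import Data.List.Relation.Unary.Unique.Propositional.Properties as UniqueP
open import Data.List.Membership.Propositional using (_∈_; find; lose)
open import Data.List.Membership.Propositional.Properties
open import Data.List.Relation.Binary.Permutation.Propositional using (_↭_; ↭-refl; ↭-sym; ↭-trans; ↭-reflexive; prep)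
open import Data.List.Relation.Binary.Permutation.Propositional.Properties
  using (shift; ++⁺ˡ; drop-∷; ∈-resp-↭; ∷↭∷ʳ; ↭-singleton-inv)
open import Data.Product using (Σ; _×_; _,_; proj₁; proj₂; ∃-syntax)
open import Data.Sum using (inj₁; inj₂)
open import Data.Empty using (⊥-elim)
open import Relation.Nullary using (¬_; yes; no; Dec; ¬?)
open import Relation.Nullary.Decidable using (_×-dec_)
open import Relation.Unary using (Decidable)
open import Relation.Binary.PropositionalEquality hiding ([_])
open import Algebra.Properties.CommutativeSemigroup ℕP.+-commutativeSemigroup using (interchange)
open import Function using (_∘_)
open import Function.Bundles using (_⇔_; mk⇔; Equivalence)

-- Coefficient arrays of polynomials in x and y

sumUpTo : ℕ → (ℕ → ℕ) → ℕ
sumUpTo n f = sum (applyUpTo f (suc n))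

sumUpTo-cong : ∀ n {f g : ℕ → ℕ} → (∀ a → a ≤ n → f a ≡ g a) → sumUpTo n f ≡ sumUpTo n g
sumUpTo-cong zero    f≗g = cong (_+ 0) (f≗g 0 z≤n)
sumUpTo-cong (suc n) f≗g =
  cong₂ _+_ (f≗g 0 z≤n) (sumUpTo-cong n (λ a a≤n → f≗g (suc a) (s≤s a≤n)))

sumUpTo-+ : ∀ n (f g : ℕ → ℕ) → sumUpTo n (λ a → f a + g a) ≡ sumUpTo n f + sumUpTo n g
sumUpTo-+ zero    f g = interchange (f 0) (g 0) 0 0
sumUpTo-+ (suc n) f g =
  trans (cong (_+_ (f 0 + g 0)) (sumUpTo-+ n (f ∘ suc) (g ∘ suc))) (interchange (f 0) (g 0) _ _)

sumUpTo-* : ∀ n c (f : ℕ → ℕ) → sumUpTo n (λ a → c * f a) ≡ c * sumUpTo n f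
sumUpTo-* zero    c f = sym (trans (ℕP.*-distribˡ-+ c (f 0) 0) (cong (_+_ (c * f 0)) (ℕP.*-zeroʳ c)))
sumUpTo-* (suc n) c f =
  trans (cong (_+_ (c * f 0)) (sumUpTo-* n c (f ∘ suc))) (sym (ℕP.*-distribˡ-+ c (f 0) _))

sumUpTo-zero : ∀ n (f : ℕ → ℕ) → (∀ a → f a ≡ 0) → sumUpTo n f ≡ 0
sumUpTo-zero zero    f f≗0 = cong (_+ 0) (f≗0 0)
sumUpTo-zero (suc n) f f≗0 = cong₂ _+_ (f≗0 0) (sumUpTo-zero n (f ∘ suc) (f≗0 ∘ suc))

sumUpTo-head : ∀ n (f : ℕ → ℕ) → (∀ a → f (suc a) ≡ 0) → sumUpTo n f ≡ f 0
sumUpTo-head zero    f _    = ℕP.+-identityʳ (f 0)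
sumUpTo-head (suc n) f tail≗0 =
  trans (cong (_+_ (f 0)) (sumUpTo-zero n (f ∘ suc) tail≗0)) (ℕP.+-identityʳ (f 0))

sumUpTo-suc : ∀ n (f : ℕ → ℕ) → sumUpTo (suc n) f ≡ sumUpTo n f + f (suc n)
sumUpTo-suc n f = begin
  sum (applyUpTo f (suc (suc n)))              ≡⟨ cong sum (LP.applyUpTo-∷ʳ f (suc n)) ⟨
  sum (applyUpTo f (suc n) ++ [ f (suc n) ])   ≡⟨ sum-++ (applyUpTo f (suc n)) [ f (suc n) ] ⟩
  sumUpTo n f + (f (suc n) + 0)                ≡⟨ cong (_+_ (sumUpTo n f)) (ℕP.+-identityʳ (f (suc n))) ⟩
  sumUpTo n f + f (suc n)                      ∎
  where open ≡-Reasoning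

Coeffs : Set
Coeffs = ℕ → ℕ → ℕ

infix 4 _≗₂_
_≗₂_ : Coeffs → Coeffs → Set
P ≗₂ Q = ∀ i j → P i j ≡ Q i j

infixl 6 _⊞_
_⊞_ : Coeffs → Coeffs → Coeffs
(P ⊞ Q) i j = P i j + Q i j

sumUpTo² : ℕ → ℕ → (ℕ → ℕ → ℕ) → ℕ
sumUpTo² i j F = sumUpTo i λ a → sumUpTo j λ b → F a b

sumUpTo²-cong : ∀ i j {F G : ℕ → ℕ → ℕ} → (∀ a b → a ≤ i → b ≤ j → F a b ≡ G a b) →
                sumUpTo² i j F ≡ sumUpTo² i j G
sumUpTo²-cong i j F≗G = sumUpTo-cong i λ a a≤i → sumUpTo-cong j λ b b≤j → F≗G a b a≤i b≤j

sumUpTo²-+ : ∀ i j (F G : ℕ → ℕ → ℕ) →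
             sumUpTo² i j (λ a b → F a b + G a b) ≡ sumUpTo² i j F + sumUpTo² i j G
sumUpTo²-+ i j F G = trans (sumUpTo-cong i λ a _ → sumUpTo-+ j (F a) (G a))
                           (sumUpTo-+ i (λ a → sumUpTo j (F a)) (λ a → sumUpTo j (G a)))

sumUpTo²-* : ∀ i j c (F : ℕ → ℕ → ℕ) → sumUpTo² i j (λ a b → c * F a b) ≡ c * sumUpTo² i j F
sumUpTo²-* i j c F = trans (sumUpTo-cong i λ a _ → sumUpTo-* j c (F a))
                           (sumUpTo-* i c (λ a → sumUpTo j (F a)))

infixl 7 _⋆_
_⋆_ : Coeffs → Coeffs → Coeffs
(P ⋆ Q) i j = sumUpTo² i j λ a b → P a b * Q (i ∸ a) (j ∸ b)

⋆-cong : ∀ {P P′ Q Q′} → P ≗₂ P′ → Q ≗₂ Q′ → P ⋆ Q ≗₂ P′ ⋆ Q′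
⋆-cong P≗P′ Q≗Q′ i j = sumUpTo²-cong i j λ a b _ _ → cong₂ _*_ (P≗P′ a b) (Q≗Q′ (i ∸ a) (j ∸ b))

⋆-congˡ : ∀ P {Q Q′} → Q ≗₂ Q′ → P ⋆ Q ≗₂ P ⋆ Q′
⋆-congˡ P = ⋆-cong {P} {P} λ _ _ → refl

⋆-congʳ : ∀ Q {P P′} → P ≗₂ P′ → P ⋆ Q ≗₂ P′ ⋆ Q
⋆-congʳ Q P≗P′ = ⋆-cong {Q = Q} {Q} P≗P′ λ _ _ → refl

⋆-distribʳ : ∀ P P′ Q → (P ⊞ P′) ⋆ Q ≗₂ P ⋆ Q ⊞ P′ ⋆ Q
⋆-distribʳ P P′ Q i j =
  trans (sumUpTo²-cong i j λ a b _ _ → ℕP.*-distribʳ-+ (Q (i ∸ a) (j ∸ b)) (P a b) (P′ a b))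
        (sumUpTo²-+ i j (λ a b → P a b * Q (i ∸ a) (j ∸ b)) (λ a b → P′ a b * Q (i ∸ a) (j ∸ b)))

⋆-distribˡ : ∀ P Q Q′ → P ⋆ (Q ⊞ Q′) ≗₂ P ⋆ Q ⊞ P ⋆ Q′
⋆-distribˡ P Q Q′ i j =
  trans (sumUpTo²-cong i j λ a b _ _ → ℕP.*-distribˡ-+ (P a b) (Q (i ∸ a) (j ∸ b)) (Q′ (i ∸ a) (j ∸ b)))
        (sumUpTo²-+ i j (λ a b → P a b * Q (i ∸ a) (j ∸ b)) (λ a b → P a b * Q′ (i ∸ a) (j ∸ b)))

mulX mulY : Coeffs → Coeffs
mulX P zero    j = 0
mulX P (suc i) j = P i j
mulY P i zero    = 0
mulY P i (suc j) = P i j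

mulX-⋆ˡ : ∀ P Q → mulX P ⋆ Q ≗₂ mulX (P ⋆ Q)
mulX-⋆ˡ P Q zero    j = cong (_+ 0) (sumUpTo-zero j _ λ _ → refl)
mulX-⋆ˡ P Q (suc i) j = cong (_+ (P ⋆ Q) i j) (sumUpTo-zero j _ λ _ → refl)

mulY-⋆ˡ : ∀ P Q → mulY P ⋆ Q ≗₂ mulY (P ⋆ Q)
mulY-⋆ˡ P Q i zero    = sumUpTo-zero i _ λ _ → refl
mulY-⋆ˡ P Q i (suc j) = refl

mulX-⋆ʳ : ∀ P Q → P ⋆ mulX Q ≗₂ mulX (P ⋆ Q)
mulX-⋆ʳ P Q zero    j = cong (_+ 0) (sumUpTo-zero j _ λ b → ℕP.*-zeroʳ (P 0 b))
mulX-⋆ʳ P Q (suc i) j = begin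
  sumUpTo (suc i) term
    ≡⟨ sumUpTo-suc i term ⟩
  sumUpTo i term + term (suc i)
    ≡⟨ cong (_+_ (sumUpTo i term)) (sumUpTo-zero j _ lastVanishes) ⟩
  sumUpTo i term + 0
    ≡⟨ ℕP.+-identityʳ _ ⟩
  sumUpTo i term
    ≡⟨ sumUpTo-cong i (λ a a≤i → sumUpTo-cong j λ b _ →
         cong (λ k → P a b * mulX Q k (j ∸ b)) (ℕP.+-∸-assoc 1 a≤i)) ⟩
  (P ⋆ Q) i j
    ∎
  where
  open ≡-Reasoning
  term : ℕ → ℕ
  term a = sumUpTo j λ b → P a b * mulX Q (suc i ∸ a) (j ∸ b)
  lastVanishes : ∀ b → P (suc i) b * mulX Q (suc i ∸ suc i) (j ∸ b) ≡ 0
  lastVanishes b rewrite ℕP.n∸n≡0 i = ℕP.*-zeroʳ (P (suc i) b)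

mulY-⋆ʳ : ∀ P Q → P ⋆ mulY Q ≗₂ mulY (P ⋆ Q)
mulY-⋆ʳ P Q i zero    = sumUpTo-zero i _ λ a → cong (_+ 0) (ℕP.*-zeroʳ (P a 0))
mulY-⋆ʳ P Q i (suc j) = sumUpTo-cong i λ a _ → begin
  sumUpTo (suc j) (term a)
    ≡⟨ sumUpTo-suc j (term a) ⟩
  sumUpTo j (term a) + term a (suc j)
    ≡⟨ cong (_+_ (sumUpTo j (term a))) (lastVanishes a) ⟩
  sumUpTo j (term a) + 0
    ≡⟨ ℕP.+-identityʳ _ ⟩
  sumUpTo j (term a)
    ≡⟨ sumUpTo-cong j (λ b b≤j → cong (λ k → P a b * mulY Q (i ∸ a) k) (ℕP.+-∸-assoc 1 b≤j)) ⟩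
  sumUpTo j (λ b → P a b * Q (i ∸ a) (j ∸ b))
    ∎
  where
  open ≡-Reasoning
  term : ℕ → ℕ → ℕ
  term a b = P a b * mulY Q (i ∸ a) (suc j ∸ b)
  lastVanishes : ∀ a → term a (suc j) ≡ 0
  lastVanishes a rewrite ℕP.n∸n≡0 j = ℕP.*-zeroʳ (P a (suc j))

-- Linear operators and derivations

record IsLinear (E : Coeffs → Coeffs) : Set where
  field
    ≗-cong : ∀ {P Q} → P ≗₂ Q → E P ≗₂ E Q
    ⊞-hom  : ∀ P Q → E (P ⊞ Q) ≗₂ E P ⊞ E Q

record IsMultiplier (M : Coeffs → Coeffs) : Set where
  field
    isLinear : IsLinear M
    ⋆-homˡ   : ∀ P Q → M P ⋆ Q ≗₂ M (P ⋆ Q)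
    ⋆-homʳ   : ∀ P Q → P ⋆ M Q ≗₂ M (P ⋆ Q)

IsDerivation : (Coeffs → Coeffs) → Set
IsDerivation E = ∀ P Q → E (P ⋆ Q) ≗₂ E P ⋆ Q ⊞ P ⋆ E Q

infixl 6 _⊞ᴼ_
_⊞ᴼ_ : (Coeffs → Coeffs) → (Coeffs → Coeffs) → Coeffs → Coeffs
(E ⊞ᴼ F) P = E P ⊞ F P

⊞ᴼ-isLinear : ∀ {E F} → IsLinear E → IsLinear F → IsLinear (E ⊞ᴼ F)
⊞ᴼ-isLinear {E} {F} linE linF = record
  { ≗-cong = λ P≗Q i j → cong₂ _+_ (E.≗-cong P≗Q i j) (F.≗-cong P≗Q i j)
  ; ⊞-hom  = λ P Q i j → trans (cong₂ _+_ (E.⊞-hom P Q i j) (F.⊞-hom P Q i j))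
                               (interchange (E P i j) (E Q i j) (F P i j) (F Q i j))
  }
  where module E = IsLinear linE; module F = IsLinear linF

∘-isLinear : ∀ {E F} → IsLinear E → IsLinear F → IsLinear (E ∘ F)
∘-isLinear {E} {F} linE linF = record
  { ≗-cong = E.≗-cong ∘ F.≗-cong
  ; ⊞-hom  = λ P Q i j → trans (E.≗-cong (F.⊞-hom P Q) i j) (E.⊞-hom (F P) (F Q) i j)
  }
  where module E = IsLinear linE; module F = IsLinear linF

⊞ᴼ-isDerivation : ∀ {E F} → IsDerivation E → IsDerivation F → IsDerivation (E ⊞ᴼ F)
⊞ᴼ-isDerivation {E} {F} derE derF P Q i j = begin
  E (P ⋆ Q) i j + F (P ⋆ Q) i j
    ≡⟨ cong₂ _+_ (derE P Q i j) (derF P Q i j) ⟩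
  ((E P ⋆ Q) i j + (P ⋆ E Q) i j) + ((F P ⋆ Q) i j + (P ⋆ F Q) i j)
    ≡⟨ interchange ((E P ⋆ Q) i j) _ _ _ ⟩
  ((E P ⋆ Q) i j + (F P ⋆ Q) i j) + ((P ⋆ E Q) i j + (P ⋆ F Q) i j)
    ≡⟨ cong₂ _+_ (⋆-distribʳ (E P) (F P) Q i j) (⋆-distribˡ P (E Q) (F Q) i j) ⟨
  ((E P ⊞ F P) ⋆ Q) i j + (P ⋆ (E Q ⊞ F Q)) i j
    ∎
  where open ≡-Reasoning

∘-isDerivation : ∀ {M E} → IsMultiplier M → IsDerivation E → IsDerivation (M ∘ E)
∘-isDerivation {M} {E} mulM derE P Q i j = begin
  M (E (P ⋆ Q)) i j                       ≡⟨ ≗-cong (derE P Q) i j ⟩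
  M (E P ⋆ Q ⊞ P ⋆ E Q) i j               ≡⟨ ⊞-hom (E P ⋆ Q) (P ⋆ E Q) i j ⟩
  M (E P ⋆ Q) i j + M (P ⋆ E Q) i j       ≡⟨ cong₂ _+_ (⋆-homˡ (E P) Q i j) (⋆-homʳ P (E Q) i j) ⟨
  (M (E P) ⋆ Q) i j + (P ⋆ M (E Q)) i j   ∎
  where
  open ≡-Reasoning
  open IsMultiplier mulM
  open IsLinear isLinear

mulX-isLinear : IsLinear mulX
mulX-isLinear = record { ≗-cong = ≗-cong ; ⊞-hom = ⊞-hom }
  where
  ≗-cong : ∀ {P Q} → P ≗₂ Q → mulX P ≗₂ mulX Q
  ≗-cong P≗Q zero    j = refl
  ≗-cong P≗Q (suc i) j = P≗Q i j
  ⊞-hom : ∀ P Q → mulX (P ⊞ Q) ≗₂ mulX P ⊞ mulX Q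
  ⊞-hom P Q zero    j = refl
  ⊞-hom P Q (suc i) j = refl

mulY-isLinear : IsLinear mulY
mulY-isLinear = record { ≗-cong = ≗-cong ; ⊞-hom = ⊞-hom }
  where
  ≗-cong : ∀ {P Q} → P ≗₂ Q → mulY P ≗₂ mulY Q
  ≗-cong P≗Q i zero    = refl
  ≗-cong P≗Q i (suc j) = P≗Q i j
  ⊞-hom : ∀ P Q → mulY (P ⊞ Q) ≗₂ mulY P ⊞ mulY Q
  ⊞-hom P Q i zero    = refl
  ⊞-hom P Q i (suc j) = refl

mulX-isMultiplier : IsMultiplier mulX
mulX-isMultiplier = record { isLinear = mulX-isLinear ; ⋆-homˡ = mulX-⋆ˡ ; ⋆-homʳ = mulX-⋆ʳ }

mulY-isMultiplier : IsMultiplier mulY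
mulY-isMultiplier = record { isLinear = mulY-isLinear ; ⋆-homˡ = mulY-⋆ˡ ; ⋆-homʳ = mulY-⋆ʳ }

weight : Coeffs → Coeffs → Coeffs
weight e P i j = e i j * P i j

weight-isLinear : ∀ e → IsLinear (weight e)
weight-isLinear e = record
  { ≗-cong = λ P≗Q i j → cong (e i j *_) (P≗Q i j)
  ; ⊞-hom  = λ P Q i j → ℕP.*-distribˡ-+ (e i j) (P i j) (Q i j)
  }

weight-isDerivation : ∀ e → (∀ {a b i j} → a ≤ i → b ≤ j → e a b + e (i ∸ a) (j ∸ b) ≡ e i j) →
                      IsDerivation (weight e)
weight-isDerivation e additive P Q i j = begin
  e i j * (P ⋆ Q) i j
    ≡⟨ sumUpTo²-* i j (e i j) term ⟨
  sumUpTo² i j (λ a b → e i j * term a b)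
    ≡⟨ sumUpTo²-cong i j (λ a b a≤i b≤j → begin
         e i j * term a b
           ≡⟨ cong (_* term a b) (additive a≤i b≤j) ⟨
         (e a b + e (i ∸ a) (j ∸ b)) * term a b
           ≡⟨ split (e a b) (e (i ∸ a) (j ∸ b)) (P a b) (Q (i ∸ a) (j ∸ b)) ⟩
         weightedˡ a b + weightedʳ a b
           ∎) ⟩
  sumUpTo² i j (λ a b → weightedˡ a b + weightedʳ a b)
    ≡⟨ sumUpTo²-+ i j weightedˡ weightedʳ ⟩
  (weight e P ⋆ Q) i j + (P ⋆ weight e Q) i j
    ∎
  where
  open ≡-Reasoning
  term weightedˡ weightedʳ : ℕ → ℕ → ℕ
  term a b = P a b * Q (i ∸ a) (j ∸ b)
  weightedˡ a b = e a b * P a b * Q (i ∸ a) (j ∸ b)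
  weightedʳ a b = P a b * (e (i ∸ a) (j ∸ b) * Q (i ∸ a) (j ∸ b))
  split : ∀ u v p q → (u + v) * (p * q) ≡ u * p * q + p * (v * q)
  split = solve-∀

θx θy : Coeffs → Coeffs
θx = weight λ i _ → i
θy = weight λ _ j → j

θx-isLinear : IsLinear θx
θx-isLinear = weight-isLinear λ i _ → i

θy-isLinear : IsLinear θy
θy-isLinear = weight-isLinear λ _ j → j

θx-isDerivation : IsDerivation θx
θx-isDerivation = weight-isDerivation _ λ a≤i _ → ℕP.m+[n∸m]≡n a≤i

θy-isDerivation : IsDerivation θy
θy-isDerivation = weight-isDerivation _ λ _ b≤j → ℕP.m+[n∸m]≡n b≤j

-- D f = x (1 + y) ∂f/∂x + y (1 + x) ∂f/∂y, and x ∂/∂x, y ∂/∂y act on coefficients as the weights θx, θy.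
Dˣ Dʸ Dᶜ : Coeffs → Coeffs
Dˣ = θx ⊞ᴼ mulY ∘ θx
Dʸ = θy ⊞ᴼ mulX ∘ θy
Dᶜ = Dˣ ⊞ᴼ Dʸ

Dˣ-isLinear : IsLinear Dˣ
Dˣ-isLinear = ⊞ᴼ-isLinear {θx} {mulY ∘ θx} θx-isLinear (∘-isLinear {mulY} {θx} mulY-isLinear θx-isLinear)

Dʸ-isLinear : IsLinear Dʸ
Dʸ-isLinear = ⊞ᴼ-isLinear {θy} {mulX ∘ θy} θy-isLinear (∘-isLinear {mulX} {θy} mulX-isLinear θy-isLinear)

Dᶜ-isLinear : IsLinear Dᶜ
Dᶜ-isLinear = ⊞ᴼ-isLinear {Dˣ} {Dʸ} Dˣ-isLinear Dʸ-isLinear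

Dˣ-isDerivation : IsDerivation Dˣ
Dˣ-isDerivation = ⊞ᴼ-isDerivation {θx} {mulY ∘ θx} θx-isDerivation
                    (∘-isDerivation {mulY} {θx} mulY-isMultiplier θx-isDerivation)

Dʸ-isDerivation : IsDerivation Dʸ
Dʸ-isDerivation = ⊞ᴼ-isDerivation {θy} {mulX ∘ θy} θy-isDerivation
                    (∘-isDerivation {mulX} {θy} mulX-isMultiplier θy-isDerivation)

Dᶜ-isDerivation : IsDerivation Dᶜ
Dᶜ-isDerivation = ⊞ᴼ-isDerivation {Dˣ} {Dʸ} Dˣ-isDerivation Dʸ-isDerivation

δ : ℕ → ℕ → ℕ
δ zero    zero    = 1
δ zero    (suc _) = 0
δ (suc _) zero    = 0
δ (suc a) (suc b) = δ a b

δ-scale : ∀ a i c → i * (δ a i * c) ≡ a * (δ a i * c)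
δ-scale zero    zero    c = refl
δ-scale zero    (suc i) c = ℕP.*-zeroʳ (suc i)
δ-scale (suc a) zero    c = sym (ℕP.*-zeroʳ (suc a))
δ-scale (suc a) (suc i) c = cong (_+_ (δ a i * c)) (δ-scale a i c)

δ-refl : ∀ a → δ a a ≡ 1
δ-refl zero    = refl
δ-refl (suc a) = δ-refl a

δ-≢ : ∀ {a b} → a ≢ b → δ a b ≡ 0
δ-≢ {zero}  {zero}  a≢b = ⊥-elim (a≢b refl)
δ-≢ {zero}  {suc b} a≢b = refl
δ-≢ {suc a} {zero}  a≢b = refl
δ-≢ {suc a} {suc b} a≢b = δ-≢ (a≢b ∘ cong suc)

mono : ℕ → ℕ → Coeffs
mono a b i j = δ a i * δ b j

infixr 7 _·_
_·_ : ℕ → Coeffs → Coeffs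
(c · P) i j = c * P i j

θx-mono : ∀ a b → θx (mono a b) ≗₂ a · mono a b
θx-mono a b i j = δ-scale a i (δ b j)

θy-mono : ∀ a b → θy (mono a b) ≗₂ b · mono a b
θy-mono a b i j = begin
  j * (δ a i * δ b j)   ≡⟨ cong (j *_) (ℕP.*-comm (δ a i) (δ b j)) ⟩
  j * (δ b j * δ a i)   ≡⟨ δ-scale b j (δ a i) ⟩
  b * (δ b j * δ a i)   ≡⟨ cong (b *_) (ℕP.*-comm (δ b j) (δ a i)) ⟩
  b * (δ a i * δ b j)   ∎
  where open ≡-Reasoning

mulX-mono : ∀ a b → mulX (mono a b) ≗₂ mono (suc a) b
mulX-mono a b zero    j = refl
mulX-mono a b (suc i) j = refl

mulY-mono : ∀ a b → mulY (mono a b) ≗₂ mono a (suc b)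
mulY-mono a b i zero    = sym (ℕP.*-zeroʳ (δ a i))
mulY-mono a b i (suc j) = refl

mulX-· : ∀ c P → mulX (c · P) ≗₂ c · mulX P
mulX-· c P zero    j = sym (ℕP.*-zeroʳ c)
mulX-· c P (suc i) j = refl

mulY-· : ∀ c P → mulY (c · P) ≗₂ c · mulY P
mulY-· c P i zero    = sym (ℕP.*-zeroʳ c)
mulY-· c P i (suc j) = refl

Dᶜ-mono : ∀ a b i j →
  Dᶜ (mono a b) i j ≡ (a + b) * mono a b i j + a * mono a (suc b) i j + b * mono (suc a) b i j
Dᶜ-mono a b i j = begin
  (θx m i j + mulY (θx m) i j) + (θy m i j + mulX (θy m) i j)
    ≡⟨ cong₂ _+_ (cong₂ _+_ (θx-mono a b i j) (mulY.≗-cong (θx-mono a b) i j))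
                 (cong₂ _+_ (θy-mono a b i j) (mulX.≗-cong (θy-mono a b) i j)) ⟩
  (a * m i j + mulY (a · m) i j) + (b * m i j + mulX (b · m) i j)
    ≡⟨ cong₂ _+_ (cong (_+_ (a * m i j)) (trans (mulY-· a m i j) (cong (a *_) (mulY-mono a b i j))))
                 (cong (_+_ (b * m i j)) (trans (mulX-· b m i j) (cong (b *_) (mulX-mono a b i j)))) ⟩
  (a * m i j + a * mono a (suc b) i j) + (b * m i j + b * mono (suc a) b i j)
    ≡⟨ regroup a b (m i j) (mono a (suc b) i j) (mono (suc a) b i j) ⟩
  (a + b) * m i j + a * mono a (suc b) i j + b * mono (suc a) b i j
    ∎
  where
  open ≡-Reasoning
  module mulX = IsLinear mulX-isLinear
  module mulY = IsLinear mulY-isLinear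
  m = mono a b
  regroup : ∀ a b u v w → (a * u + a * v) + (b * u + b * w) ≡ (a + b) * u + a * v + b * w
  regroup = solve-∀

-- Coefficients of constant-free polynomials

⟦_⟧ : ℕ → ℚ
⟦ m ⟧ = + m / 1

toℚᵘ-⟦⟧ : ∀ m → toℚᵘ ⟦ m ⟧ ≡ ℚᵘ.mkℚᵘ (+ m) 0
toℚᵘ-⟦⟧ m = cong toℚᵘ (ℚP.normalize-coprime {m} {0} (Coprime.sym (Coprime.1-coprimeTo m)))

⟦⟧-+ : ∀ m n → ⟦ m + n ⟧ ≡ ⟦ m ⟧ ℚ.+ ⟦ n ⟧
⟦⟧-+ m n =
  ℚP.toℚᵘ-injective (ℚᵘP.≃-trans unnormalised (ℚᵘP.≃-sym (ℚP.toℚᵘ-homo-+ ⟦ m ⟧ ⟦ n ⟧)))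
  where
  unnormalised : toℚᵘ ⟦ m + n ⟧ ℚᵘ.≃ toℚᵘ ⟦ m ⟧ ℚᵘ.+ toℚᵘ ⟦ n ⟧
  unnormalised rewrite toℚᵘ-⟦⟧ m | toℚᵘ-⟦⟧ n | toℚᵘ-⟦⟧ (m + n) = ℚᵘ.*≡* (begin
    + (m + n) ℤ.* + 1                           ≡⟨ ℤP.*-identityʳ (+ (m + n)) ⟩
    + m ℤ.+ + n                                 ≡⟨ cong₂ ℤ._+_ (ℤP.*-identityʳ (+ m)) (ℤP.*-identityʳ (+ n)) ⟨
    + m ℤ.* + 1 ℤ.+ + n ℤ.* + 1                 ≡⟨ ℤP.*-identityʳ _ ⟨
    (+ m ℤ.* + 1 ℤ.+ + n ℤ.* + 1) ℤ.* + 1       ∎)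
    where open ≡-Reasoning

⟦⟧-* : ∀ m n → ⟦ m * n ⟧ ≡ ⟦ m ⟧ ℚ.* ⟦ n ⟧
⟦⟧-* m n =
  ℚP.toℚᵘ-injective (ℚᵘP.≃-trans unnormalised (ℚᵘP.≃-sym (ℚP.toℚᵘ-homo-* ⟦ m ⟧ ⟦ n ⟧)))
  where
  unnormalised : toℚᵘ ⟦ m * n ⟧ ℚᵘ.≃ toℚᵘ ⟦ m ⟧ ℚᵘ.* toℚᵘ ⟦ n ⟧
  unnormalised rewrite toℚᵘ-⟦⟧ m | toℚᵘ-⟦⟧ n | toℚᵘ-⟦⟧ (m * n) =
    ℚᵘ.*≡* (begin
      + (m * n) ℤ.* + 1       ≡⟨ ℤP.*-identityʳ (+ (m * n)) ⟩
      + (m * n)               ≡⟨ ℤP.pos-* m n ⟩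
      + m ℤ.* + n             ≡⟨ ℤP.*-identityʳ (+ m ℤ.* + n) ⟨
      + m ℤ.* + n ℤ.* + 1     ∎)
    where open ≡-Reasoning

⟦⟧-sum : ∀ xs → foldr ℚ._+_ 0ℚ (map ⟦_⟧ xs) ≡ ⟦ sum xs ⟧
⟦⟧-sum []       = refl
⟦⟧-sum (x ∷ xs) = trans (cong (⟦ x ⟧ ℚ.+_) (⟦⟧-sum xs)) (sym (⟦⟧-+ x (sum xs)))

sumTo-⟦⟧ : ∀ n {g : ℕ → ℚ} (f : ℕ → ℕ) → (∀ a → g a ≡ ⟦ f a ⟧) → sumTo n g ≡ ⟦ sumUpTo n f ⟧
sumTo-⟦⟧ n {g} f g≗f = begin
  sumℚ (map g range)              ≡⟨ cong sumℚ (LP.map-cong g≗f range) ⟩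
  sumℚ (map (⟦_⟧ ∘ f) range)      ≡⟨ cong sumℚ (LP.map-∘ {g = ⟦_⟧} {f} range) ⟩
  sumℚ (map ⟦_⟧ (map f range))    ≡⟨ ⟦⟧-sum (map f range) ⟩
  ⟦ sum (map f range) ⟧           ≡⟨ cong (⟦_⟧ ∘ sum) (LP.map-upTo f (suc n)) ⟩
  ⟦ sumUpTo n f ⟧                 ∎
  where
  open ≡-Reasoning
  sumℚ = foldr ℚ._+_ 0ℚ
  range = upTo (suc n)

-- Built from x and y alone, so that all coefficients are natural numbers.
data ConstantFree : Poly → Set where
  X   : ConstantFree X
  Y   : ConstantFree Y
  _⊕_ : ∀ {p q} → ConstantFree p → ConstantFree q → ConstantFree (p ⊕ q)
  _⊗_ : ∀ {p q} → ConstantFree p → ConstantFree q → ConstantFree (p ⊗ q)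

D-constantFree : ∀ {p} → ConstantFree p → ConstantFree (D p)
D-constantFree X       = X ⊕ (X ⊗ Y)
D-constantFree Y       = Y ⊕ (X ⊗ Y)
D-constantFree (s ⊕ t) = D-constantFree s ⊕ D-constantFree t
D-constantFree (s ⊗ t) = (D-constantFree s ⊗ t) ⊕ (s ⊗ D-constantFree t)

iterD-constantFree : ∀ n → ConstantFree (iterD n X)
iterD-constantFree zero    = X
iterD-constantFree (suc n) = D-constantFree (iterD-constantFree n)

ncoeff : ∀ {p} → ConstantFree p → Coeffs
ncoeff X       = mono 1 0
ncoeff Y       = mono 0 1
ncoeff (s ⊕ t) = ncoeff s ⊞ ncoeff t
ncoeff (s ⊗ t) = ncoeff s ⋆ ncoeff t

coeff≡⟦ncoeff⟧ : ∀ {p} (t : ConstantFree p) i j → coeff p i j ≡ ⟦ ncoeff t i j ⟧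
coeff≡⟦ncoeff⟧ X zero          j             = refl
coeff≡⟦ncoeff⟧ X (suc zero)    zero          = refl
coeff≡⟦ncoeff⟧ X (suc zero)    (suc j)       = refl
coeff≡⟦ncoeff⟧ X (suc (suc i)) j             = refl
coeff≡⟦ncoeff⟧ Y zero          zero          = refl
coeff≡⟦ncoeff⟧ Y zero          (suc zero)    = refl
coeff≡⟦ncoeff⟧ Y zero          (suc (suc j)) = refl
coeff≡⟦ncoeff⟧ Y (suc i)       j             = refl
coeff≡⟦ncoeff⟧ (s ⊕ t) i j =
  trans (cong₂ ℚ._+_ (coeff≡⟦ncoeff⟧ s i j) (coeff≡⟦ncoeff⟧ t i j))
        (sym (⟦⟧-+ (ncoeff s i j) (ncoeff t i j)))
coeff≡⟦ncoeff⟧ (s ⊗ t) i j =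
  sumTo-⟦⟧ i (λ a → sumUpTo j λ b → ncoeff s a b * ncoeff t (i ∸ a) (j ∸ b)) λ a →
  sumTo-⟦⟧ j (λ b → ncoeff s a b * ncoeff t (i ∸ a) (j ∸ b)) λ b →
    trans (cong₂ ℚ._*_ (coeff≡⟦ncoeff⟧ s a b) (coeff≡⟦ncoeff⟧ t (i ∸ a) (j ∸ b)))
          (sym (⟦⟧-* (ncoeff s a b) (ncoeff t (i ∸ a) (j ∸ b))))

mono-unit : ∀ P → mono 0 0 ⋆ P ≗₂ P
mono-unit P i j = begin
  (mono 0 0 ⋆ P) i j   ≡⟨ sumUpTo-head i (sumUpTo j ∘ term) (λ a → sumUpTo-zero j (term (suc a)) λ _ → refl) ⟩
  sumUpTo j (term 0)   ≡⟨ sumUpTo-head j (term 0) (λ _ → refl) ⟩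
  1 * P i j            ≡⟨ ℕP.*-identityˡ (P i j) ⟩
  P i j                ∎
  where
  open ≡-Reasoning
  term : ℕ → ℕ → ℕ
  term a b = mono 0 0 a b * P (i ∸ a) (j ∸ b)

mono10⋆mono01 : mono 1 0 ⋆ mono 0 1 ≗₂ mono 1 1
mono10⋆mono01 i j = begin
  (mono 1 0 ⋆ mono 0 1) i j          ≡⟨ ⋆-congʳ (mono 0 1) (λ i j → sym (mulX-mono 0 0 i j)) i j ⟩
  (mulX (mono 0 0) ⋆ mono 0 1) i j   ≡⟨ mulX-⋆ˡ (mono 0 0) (mono 0 1) i j ⟩
  mulX (mono 0 0 ⋆ mono 0 1) i j     ≡⟨ IsLinear.≗-cong mulX-isLinear (mono-unit (mono 0 1)) i j ⟩
  mulX (mono 0 1) i j                ≡⟨ mulX-mono 0 1 i j ⟩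
  mono 1 1 i j                       ∎
  where open ≡-Reasoning

ncoeff-D : ∀ {p} (t : ConstantFree p) → ncoeff (D-constantFree t) ≗₂ Dᶜ (ncoeff t)
ncoeff-D X i j = begin
  mono 1 0 i j + (mono 1 0 ⋆ mono 0 1) i j
    ≡⟨ cong (_+_ (mono 1 0 i j)) (mono10⋆mono01 i j) ⟩
  mono 1 0 i j + mono 1 1 i j
    ≡⟨ arith (mono 1 0 i j) (mono 1 1 i j) (mono 2 0 i j) ⟩
  (1 + 0) * mono 1 0 i j + 1 * mono 1 1 i j + 0 * mono 2 0 i j
    ≡⟨ Dᶜ-mono 1 0 i j ⟨
  Dᶜ (mono 1 0) i j
    ∎
  where
  open ≡-Reasoning
  arith : ∀ u v w → u + v ≡ (1 + 0) * u + 1 * v + 0 * w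
  arith = solve-∀
ncoeff-D Y i j = begin
  mono 0 1 i j + (mono 1 0 ⋆ mono 0 1) i j
    ≡⟨ cong (_+_ (mono 0 1 i j)) (mono10⋆mono01 i j) ⟩
  mono 0 1 i j + mono 1 1 i j
    ≡⟨ arith (mono 0 1 i j) (mono 1 1 i j) (mono 0 2 i j) ⟩
  (0 + 1) * mono 0 1 i j + 0 * mono 0 2 i j + 1 * mono 1 1 i j
    ≡⟨ Dᶜ-mono 0 1 i j ⟨
  Dᶜ (mono 0 1) i j
    ∎
  where
  open ≡-Reasoning
  arith : ∀ u v w → u + v ≡ (0 + 1) * u + 0 * w + 1 * v
  arith = solve-∀
ncoeff-D (s ⊕ t) i j =
  trans (cong₂ _+_ (ncoeff-D s i j) (ncoeff-D t i j))
        (sym (IsLinear.⊞-hom Dᶜ-isLinear (ncoeff s) (ncoeff t) i j))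
ncoeff-D (s ⊗ t) i j = begin
  (ncoeff (D-constantFree s) ⋆ ncoeff t) i j + (ncoeff s ⋆ ncoeff (D-constantFree t)) i j
    ≡⟨ cong₂ _+_ (⋆-congʳ (ncoeff t) (ncoeff-D s) i j) (⋆-congˡ (ncoeff s) (ncoeff-D t) i j) ⟩
  (Dᶜ (ncoeff s) ⋆ ncoeff t) i j + (ncoeff s ⋆ Dᶜ (ncoeff t)) i j
    ≡⟨ Dᶜ-isDerivation (ncoeff s) (ncoeff t) i j ⟨
  Dᶜ (ncoeff s ⋆ ncoeff t) i j
    ∎
  where open ≡-Reasoning

-- Cyclically ordered partitions, generated by inserting the maximum

Partition : Set
Partition = List (List ℕ)

appendToBlock : ℕ → Partition → List Partition
appendToBlock t []      = []
appendToBlock t (b ∷ π) = ((b ++ [ t ]) ∷ π) ∷ map (b ∷_) (appendToBlock t π)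

-- The new block never goes in front: the first block has to keep the element 1.
insertBlock : ℕ → Partition → List Partition
insertBlock t []      = []
insertBlock t (b ∷ π) = (b ∷ [ t ] ∷ π) ∷ map (b ∷_) (insertBlock t π)

extensions : ℕ → Partition → List Partition
extensions t π = appendToBlock t π ++ insertBlock t π

-- The cyclically ordered partitions of {1, …, n + 1} (note the shift).
cyclicPartitions : ℕ → List Partition
cyclicPartitions zero    = [ [ [ 1 ] ] ]
cyclicPartitions (suc n) = concatMap (extensions (suc (suc n))) (cyclicPartitions n)

appendToBlock-∈⁻ : ∀ t σ {π} → π ∈ appendToBlock t σ →
  ∃[ pre ] ∃[ b ] ∃[ post ] (σ ≡ pre ++ b ∷ post × π ≡ pre ++ (b ++ [ t ]) ∷ post)
appendToBlock-∈⁻ t (b ∷ σ) (here refl) = [] , b , σ , refl , refl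
appendToBlock-∈⁻ t (b ∷ σ) (there π∈) with ∈-map⁻ (b ∷_) π∈
... | π′ , π′∈ , refl with appendToBlock-∈⁻ t σ π′∈
... | pre , c , post , refl , refl = b ∷ pre , c , post , refl , refl

appendToBlock-∈⁺ : ∀ t pre b post → pre ++ (b ++ [ t ]) ∷ post ∈ appendToBlock t (pre ++ b ∷ post)
appendToBlock-∈⁺ t []        b post = here refl
appendToBlock-∈⁺ t (c ∷ pre) b post = there (∈-map⁺ (c ∷_) (appendToBlock-∈⁺ t pre b post))

insertBlock-∈⁻ : ∀ t σ {π} → π ∈ insertBlock t σ →
  ∃[ c ] ∃[ pre ] ∃[ post ] (σ ≡ c ∷ pre ++ post × π ≡ c ∷ pre ++ [ t ] ∷ post)
insertBlock-∈⁻ t (b ∷ σ) (here refl) = b , [] , σ , refl , refl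
insertBlock-∈⁻ t (b ∷ σ) (there π∈) with ∈-map⁻ (b ∷_) π∈
... | π′ , π′∈ , refl with insertBlock-∈⁻ t σ π′∈
... | c , pre , post , refl , refl = b , c ∷ pre , post , refl , refl

insertBlock-∈⁺ : ∀ t c pre post → c ∷ pre ++ [ t ] ∷ post ∈ insertBlock t (c ∷ pre ++ post)
insertBlock-∈⁺ t c []        post = here refl
insertBlock-∈⁺ t c (d ∷ pre) post = there (∈-map⁺ (c ∷_) (insertBlock-∈⁺ t d pre post))

concat-middle : ∀ (pre : Partition) b post → concat (pre ++ b ∷ post) ≡ concat pre ++ b ++ concat post
concat-middle []        b post = refl
concat-middle (c ∷ pre) b post =
  trans (cong (c ++_) (concat-middle pre b post)) (sym (LP.++-assoc c (concat pre) _))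

concat-appendToBlock : ∀ t pre b post → concat (pre ++ (b ++ [ t ]) ∷ post) ↭ t ∷ concat (pre ++ b ∷ post)
concat-appendToBlock t pre b post =
  ↭-trans (↭-reflexive (trans (concat-middle pre (b ++ [ t ]) post)
                              (cong (concat pre ++_) (LP.++-assoc b [ t ] (concat post)))))
  (↭-trans (++⁺ˡ (concat pre) (shift t b (concat post)))
  (↭-trans (shift t (concat pre) (b ++ concat post))
           (↭-reflexive (cong (t ∷_) (sym (concat-middle pre b post))))))

concat-insertBlock : ∀ t (pre : Partition) post → concat (pre ++ [ t ] ∷ post) ↭ t ∷ concat (pre ++ post)
concat-insertBlock t pre post =
  ↭-trans (↭-reflexive (concat-middle pre [ t ] post))
  (↭-trans (shift t (concat pre) (concat post))
           (↭-reflexive (cong (t ∷_) (LP.concat-++ pre post))))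

oneTo-suc : ∀ m → oneTo (suc m) ↭ suc m ∷ oneTo m
oneTo-suc m =
  ↭-trans (↭-reflexive (trans (cong (map suc) (sym (LP.upTo-∷ʳ m))) (LP.map-++ suc (upTo m) [ m ])))
          (↭-sym (∷↭∷ʳ (suc m) (oneTo m)))

∈-oneTo⁻ : ∀ {x m} → x ∈ oneTo m → x ≤ m
∈-oneTo⁻ x∈ with ∈-map⁻ suc x∈
... | y , y∈ , refl = ∈-upTo⁻ y∈

Linked-∷ʳ : ∀ {b t} → Linked _<_ b → All (_< t) b → Linked _<_ (b ++ [ t ])
Linked-∷ʳ []      []            = [-]
Linked-∷ʳ [-]     (x<t ∷ [])    = x<t ∷ [-]
Linked-∷ʳ (r ∷ l) (_ ∷ rest<t)  = r ∷ Linked-∷ʳ l rest<t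

Linked-∷ʳ⁻ : ∀ {b t} → Linked _<_ (b ++ [ t ]) → Linked _<_ b
Linked-∷ʳ⁻ {[]}        _       = []
Linked-∷ʳ⁻ {x ∷ []}    _       = [-]
Linked-∷ʳ⁻ {x ∷ y ∷ b} (r ∷ l) = r ∷ Linked-∷ʳ⁻ {y ∷ b} l

maximum-last : ∀ {b t} → Linked _<_ b → All (_≤ t) b → t ∈ b → ∃[ b′ ] b ≡ b′ ++ [ t ]
maximum-last {x ∷ []}    _       _             (here refl) = [] , refl
maximum-last {x ∷ y ∷ b} (r ∷ l) (_ ∷ y≤t ∷ _) (here refl) = ⊥-elim (ℕP.<⇒≱ r y≤t)
maximum-last {x ∷ y ∷ b} (r ∷ l) (_ ∷ ≤t)      (there t∈)  with maximum-last l ≤t t∈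
... | b′ , eq = x ∷ b′ , cong (x ∷_) eq

All-middle⁻ : ∀ {P : List ℕ → Set} pre {b post} → All P (pre ++ b ∷ post) → All P pre × P b × All P post
All-middle⁻ pre ps with AllP.++⁻ pre ps
... | ps₁ , (p ∷ ps₂) = ps₁ , p , ps₂

All-middle⁺ : ∀ {P : List ℕ → Set} {pre b post} → All P pre → P b → All P post → All P (pre ++ b ∷ post)
All-middle⁺ ps₁ p ps₂ = AllP.++⁺ ps₁ (p ∷ ps₂)

entries-≤ : ∀ {m π b} → CycOrdPartition m π → b ∈ π → All (_≤ m) b
entries-≤ (_ , _ , perm , _) b∈ = All.tabulate λ x∈ → ∈-oneTo⁻ (∈-resp-↭ perm (∈-concat⁺′ x∈ b∈))

entries-< : ∀ {m π} → CycOrdPartition m π → All (All (_< suc m)) π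
entries-< v = All.tabulate λ b∈ → All.map s≤s (entries-≤ v b∈)

∷ʳ-nonEmpty : ∀ b t → NonEmpty (b ++ [ t ])
∷ʳ-nonEmpty []      t = nonEmpty
∷ʳ-nonEmpty (x ∷ b) t = nonEmpty

firstContainsOne-∷ʳ : ∀ pre {b post} t →
                      FirstContainsOne (pre ++ b ∷ post) → FirstContainsOne (pre ++ (b ++ [ t ]) ∷ post)
firstContainsOne-∷ʳ []        t 1∈b = ∈-++⁺ˡ 1∈b
firstContainsOne-∷ʳ (c ∷ pre) t 1∈c = 1∈c

firstContainsOne-∷ʳ⁻ : ∀ pre {b post t} → 1 ≢ t →
                       FirstContainsOne (pre ++ (b ++ [ t ]) ∷ post) → FirstContainsOne (pre ++ b ∷ post)
firstContainsOne-∷ʳ⁻ []        {b} 1≢t 1∈ with ∈-++⁻ b 1∈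
... | inj₁ 1∈b        = 1∈b
... | inj₂ (here 1≡t) = ⊥-elim (1≢t 1≡t)
firstContainsOne-∷ʳ⁻ (c ∷ pre) 1≢t 1∈c = 1∈c

appendToBlock-sound : ∀ {m} pre b post → CycOrdPartition m (pre ++ b ∷ post) →
                      CycOrdPartition (suc m) (pre ++ (b ++ [ suc m ]) ∷ post)
appendToBlock-sound {m} pre b post v@(nonEmpties , linked , perm , first)
  with All-middle⁻ pre nonEmpties | All-middle⁻ pre linked
... | ne₁ , _ , ne₂ | l₁ , l , l₂ =
  All-middle⁺ ne₁ (∷ʳ-nonEmpty b (suc m)) ne₂ ,
  All-middle⁺ l₁ (Linked-∷ʳ l (All.lookup (entries-< v) (∈-++⁺ʳ pre (here refl)))) l₂ ,
  ↭-trans (concat-appendToBlock (suc m) pre b post) (↭-trans (prep (suc m) perm) (↭-sym (oneTo-suc m))) ,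
  firstContainsOne-∷ʳ pre (suc m) first

insertBlock-sound : ∀ {m} c pre post → CycOrdPartition m (c ∷ pre ++ post) →
                    CycOrdPartition (suc m) (c ∷ pre ++ [ suc m ] ∷ post)
insertBlock-sound {m} c pre post (nonEmpties , linked , perm , first) =
  All-middle⁺ {pre = c ∷ pre} (AllP.++⁻ˡ (c ∷ pre) nonEmpties) nonEmpty (AllP.++⁻ʳ (c ∷ pre) nonEmpties) ,
  All-middle⁺ {pre = c ∷ pre} (AllP.++⁻ˡ (c ∷ pre) linked)     [-]      (AllP.++⁻ʳ (c ∷ pre) linked) ,
  ↭-trans (concat-insertBlock (suc m) (c ∷ pre) post) (↭-trans (prep (suc m) perm) (↭-sym (oneTo-suc m))) ,
  first

extensions-sound : ∀ {m σ π} → CycOrdPartition m σ → π ∈ extensions (suc m) σ → CycOrdPartition (suc m) π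
extensions-sound {m} {σ} v π∈ with ∈-++⁻ (appendToBlock (suc m) σ) π∈
... | inj₁ π∈A with appendToBlock-∈⁻ (suc m) σ π∈A
...   | pre , b , post , refl , refl = appendToBlock-sound pre b post v
extensions-sound {m} {σ} v π∈ | inj₂ π∈I with insertBlock-∈⁻ (suc m) σ π∈I
...   | c , pre , post , refl , refl = insertBlock-sound c pre post v

cyclicPartitions-sound : ∀ n {π} → π ∈ cyclicPartitions n → CycOrdPartition (suc n) π
cyclicPartitions-sound zero    (here refl) = nonEmpty ∷ [] , [-] ∷ [] , ↭-refl , here refl
cyclicPartitions-sound (suc n) π∈
  with find (∈-concatMap⁻ (extensions (suc (suc n))) {xs = cyclicPartitions n} π∈)
... | σ , σ∈ , π∈σ = extensions-sound (cyclicPartitions-sound n σ∈) π∈σ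

module _ {m : ℕ} where

  private
    t = suc (suc m)

  insertBlock-complete : ∀ pre post → CycOrdPartition t (pre ++ [ t ] ∷ post) →
                         ∃[ σ ] (CycOrdPartition (suc m) σ × pre ++ [ t ] ∷ post ∈ extensions t σ)
  insertBlock-complete []        post (_ , _ , _ , here ())
  insertBlock-complete []        post (_ , _ , _ , there ())
  insertBlock-complete (c ∷ pre) post (nonEmpties , linked , perm , first)
    with All-middle⁻ (c ∷ pre) nonEmpties | All-middle⁻ (c ∷ pre) linked
  ... | ne₁ , _ , ne₂ | l₁ , _ , l₂ =
    c ∷ pre ++ post ,
    (AllP.++⁺ ne₁ ne₂ , AllP.++⁺ l₁ l₂ ,
     drop-∷ (↭-trans (↭-sym (concat-insertBlock t (c ∷ pre) post)) (↭-trans perm (oneTo-suc (suc m)))) ,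
     first) ,
    ∈-++⁺ʳ (appendToBlock t (c ∷ pre ++ post)) (insertBlock-∈⁺ t c pre post)

  appendToBlock-complete : ∀ pre b post → NonEmpty b → CycOrdPartition t (pre ++ (b ++ [ t ]) ∷ post) →
                           ∃[ σ ] (CycOrdPartition (suc m) σ × pre ++ (b ++ [ t ]) ∷ post ∈ extensions t σ)
  appendToBlock-complete pre b post nonEmpty-b (nonEmpties , linked , perm , first)
    with All-middle⁻ pre nonEmpties | All-middle⁻ pre linked
  ... | ne₁ , _ , ne₂ | l₁ , l , l₂ =
    pre ++ b ∷ post ,
    (All-middle⁺ ne₁ nonEmpty-b ne₂ , All-middle⁺ l₁ (Linked-∷ʳ⁻ {b} l) l₂ ,
     drop-∷ (↭-trans (↭-sym (concat-appendToBlock t pre b post)) (↭-trans perm (oneTo-suc (suc m)))) ,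
     firstContainsOne-∷ʳ⁻ pre (λ ()) first) ,
    ∈-++⁺ˡ (appendToBlock-∈⁺ t pre b post)

  extensions-complete : ∀ {π} → CycOrdPartition t π →
                        ∃[ σ ] (CycOrdPartition (suc m) σ × π ∈ extensions t σ)
  extensions-complete {π} v@(_ , linked , perm , _)
    with ∈-concat⁻′ π (∈-resp-↭ (↭-sym perm) (∈-resp-↭ (↭-sym (oneTo-suc (suc m))) (here refl)))
  ... | b , t∈b , b∈π with ∈-∃++ b∈π
  ... | pre , post , refl with maximum-last (proj₁ (proj₂ (All-middle⁻ pre linked))) (entries-≤ v b∈π) t∈b
  ... | []      , refl = insertBlock-complete pre post v
  ... | x ∷ b′ , refl = appendToBlock-complete pre (x ∷ b′) post nonEmpty v

concat-[] : ∀ {π : Partition} → All NonEmpty π → concat π ≡ [] → π ≡ []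
concat-[] []             _  = refl
concat-[] (nonEmpty ∷ _) ()

cyclicPartitions-base : ∀ {π} → CycOrdPartition 1 π → π ∈ cyclicPartitions 0
cyclicPartitions-base {[]}          (_ , _ , _ , ())
cyclicPartitions-base {[] ∷ π}      (() ∷ _ , _)
cyclicPartitions-base {(x ∷ b) ∷ π} (_ ∷ nonEmpties , _ , perm , _) with ↭-singleton-inv perm
... | eq with cong head eq | LP.∷-injectiveʳ eq
... | refl | b++π≡[]
  with LP.++-conicalˡ b (concat π) b++π≡[] | concat-[] nonEmpties (LP.++-conicalʳ b (concat π) b++π≡[])
... | refl | refl = here refl

cyclicPartitions-complete : ∀ n {π} → CycOrdPartition (suc n) π → π ∈ cyclicPartitions n
cyclicPartitions-complete zero    v = cyclicPartitions-base v
cyclicPartitions-complete (suc n) v with extensions-complete v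
... | σ , vσ , π∈ = ∈-concatMap⁺ (extensions (suc (suc n))) (lose (cyclicPartitions-complete n vσ) π∈)

nonEmpty? : Decidable NonEmpty
nonEmpty? []      = no λ ()
nonEmpty? (_ ∷ _) = yes nonEmpty

≢? : ∀ t → Decidable (_≢ t)
≢? t x = ¬? (x ℕP.≟ t)

delete : ℕ → List ℕ → List ℕ
delete t = filter (≢? t)

deleteEntry : ℕ → Partition → Partition
deleteEntry t π = filter nonEmpty? (map (delete t) π)

module _ {t : ℕ} where

  delete-below : ∀ {b} → All (_< t) b → delete t b ≡ b
  delete-below b<t = LP.filter-all (≢? t) (All.map ℕP.<⇒≢ b<t)

  delete-∷ʳ : ∀ {b} → All (_< t) b → delete t (b ++ [ t ]) ≡ b
  delete-∷ʳ {b} b<t = begin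
    delete t (b ++ [ t ])            ≡⟨ LP.filter-++ (≢? t) b [ t ] ⟩
    delete t b ++ delete t [ t ]     ≡⟨ cong₂ _++_ (delete-below b<t) (LP.filter-reject (≢? t) λ t≢t → t≢t refl) ⟩
    b ++ []                          ≡⟨ LP.++-identityʳ b ⟩
    b                                ∎
    where open ≡-Reasoning

  map-delete-around : ∀ {pre post} → All (All (_< t)) pre → All (All (_< t)) post → ∀ b →
                      map (delete t) (pre ++ b ∷ post) ≡ pre ++ delete t b ∷ post
  map-delete-around {pre} {post} pre<t post<t b =
    trans (LP.map-++ (delete t) pre (b ∷ post))
          (cong₂ (λ xs ys → xs ++ delete t b ∷ ys) (LP.map-id-local (All.map delete-below pre<t))
                                                   (LP.map-id-local (All.map delete-below post<t)))

-- Deleting the maximum undoes every extension, so extensions of distinct partitions are disjoint.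
deleteEntry-extensions : ∀ {m σ π} → CycOrdPartition m σ → π ∈ extensions (suc m) σ → deleteEntry (suc m) π ≡ σ
deleteEntry-extensions {m} {σ} v π∈ with ∈-++⁻ (appendToBlock (suc m) σ) π∈
... | inj₁ π∈A with appendToBlock-∈⁻ (suc m) σ π∈A
...   | pre , b , post , refl , refl with All-middle⁻ pre (entries-< v)
...     | pre<t , b<t , post<t = begin
  filter nonEmpty? (map (delete (suc m)) (pre ++ (b ++ [ suc m ]) ∷ post))
    ≡⟨ cong (filter nonEmpty?) (map-delete-around pre<t post<t (b ++ [ suc m ])) ⟩
  filter nonEmpty? (pre ++ delete (suc m) (b ++ [ suc m ]) ∷ post)
    ≡⟨ cong (λ b′ → filter nonEmpty? (pre ++ b′ ∷ post)) (delete-∷ʳ b<t) ⟩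
  filter nonEmpty? (pre ++ b ∷ post)
    ≡⟨ LP.filter-all nonEmpty? (proj₁ v) ⟩
  pre ++ b ∷ post
    ∎
  where open ≡-Reasoning
deleteEntry-extensions {m} {σ} v π∈ | inj₂ π∈I with insertBlock-∈⁻ (suc m) σ π∈I
...   | c , pre , post , refl , refl with AllP.++⁻ (c ∷ pre) (entries-< v) | AllP.++⁻ (c ∷ pre) (proj₁ v)
...     | pre<t , post<t | nePre , nePost = begin
  filter nonEmpty? (map (delete (suc m)) ((c ∷ pre) ++ [ suc m ] ∷ post))
    ≡⟨ cong (filter nonEmpty?) (map-delete-around pre<t post<t [ suc m ]) ⟩
  filter nonEmpty? ((c ∷ pre) ++ delete (suc m) [ suc m ] ∷ post)
    ≡⟨ cong (λ b′ → filter nonEmpty? ((c ∷ pre) ++ b′ ∷ post)) (delete-∷ʳ {suc m} {[]} []) ⟩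
  filter nonEmpty? ((c ∷ pre) ++ [] ∷ post)
    ≡⟨ LP.filter-++ nonEmpty? (c ∷ pre) ([] ∷ post) ⟩
  filter nonEmpty? (c ∷ pre) ++ filter nonEmpty? post
    ≡⟨ cong₂ _++_ (LP.filter-all nonEmpty? nePre) (LP.filter-all nonEmpty? nePost) ⟩
  c ∷ pre ++ post
    ∎
  where open ≡-Reasoning

∷ʳ-≢ : ∀ (b : List ℕ) t → b ++ [ t ] ≢ b
∷ʳ-≢ []      t ()
∷ʳ-≢ (x ∷ b) t eq = ∷ʳ-≢ b t (LP.∷-injectiveʳ eq)

appendToBlock-unique : ∀ t σ → Unique (appendToBlock t σ)
appendToBlock-unique t []      = []
appendToBlock-unique t (b ∷ σ) =
  All.tabulate first≢ ∷ UniqueP.map⁺ LP.∷-injectiveʳ (appendToBlock-unique t σ)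
  where
  first≢ : ∀ {π} → π ∈ map (b ∷_) (appendToBlock t σ) → (b ++ [ t ]) ∷ σ ≢ π
  first≢ π∈ eq with ∈-map⁻ (b ∷_) π∈
  ... | _ , _ , refl = ∷ʳ-≢ b t (LP.∷-injectiveˡ eq)

insertBlock-unique : ∀ t σ → All (All (_< t)) σ → Unique (insertBlock t σ)
insertBlock-unique t []      _          = []
insertBlock-unique t (b ∷ σ) (_ ∷ σ<t) =
  All.tabulate first≢ ∷ UniqueP.map⁺ LP.∷-injectiveʳ (insertBlock-unique t σ σ<t)
  where
  first≢ : ∀ {π} → π ∈ map (b ∷_) (insertBlock t σ) → b ∷ [ t ] ∷ σ ≢ π
  first≢ π∈ eq with ∈-map⁻ (b ∷_) π∈
  ... | _ , π′∈ , refl with insertBlock-∈⁻ t σ π′∈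
  ... | c , pre , post , refl , refl with LP.∷-injectiveˡ (LP.∷-injectiveʳ eq)
  ... | refl = ℕP.<-irrefl refl (All.head (All.head σ<t))

appendToBlock-length : ∀ t σ {π} → π ∈ appendToBlock t σ → length π ≡ length σ
appendToBlock-length t (b ∷ σ) (here refl) = refl
appendToBlock-length t (b ∷ σ) (there π∈) with ∈-map⁻ (b ∷_) π∈
... | _ , π′∈ , refl = cong suc (appendToBlock-length t σ π′∈)

insertBlock-length : ∀ t σ {π} → π ∈ insertBlock t σ → length π ≡ suc (length σ)
insertBlock-length t (b ∷ σ) (here refl) = refl
insertBlock-length t (b ∷ σ) (there π∈) with ∈-map⁻ (b ∷_) π∈
... | _ , π′∈ , refl = cong suc (insertBlock-length t σ π′∈)

extensions-unique : ∀ {m σ} → CycOrdPartition m σ → Unique (extensions (suc m) σ)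
extensions-unique {m} {σ} v =
  UniqueP.++⁺ (appendToBlock-unique (suc m) σ) (insertBlock-unique (suc m) σ (entries-< v))
    λ (π∈A , π∈I) → ℕP.1+n≢n (trans (sym (insertBlock-length (suc m) σ π∈I))
                                    (appendToBlock-length (suc m) σ π∈A))

concatMap-extensions-unique : ∀ {m} σs → Unique σs → (∀ {σ} → σ ∈ σs → CycOrdPartition m σ) →
                              Unique (concatMap (extensions (suc m)) σs)
concatMap-extensions-unique []       _           _     = []
concatMap-extensions-unique {m} (σ ∷ σs) (σ∉ ∷ unique) valid =
  UniqueP.++⁺ (extensions-unique (valid (here refl)))
              (concatMap-extensions-unique σs unique (valid ∘ there))
              disjoint
  where
  disjoint : ∀ {π} → ¬ (π ∈ extensions (suc m) σ × π ∈ concatMap (extensions (suc m)) σs)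
  disjoint (π∈σ , π∈σs) with find (∈-concatMap⁻ (extensions (suc m)) {xs = σs} π∈σs)
  ... | τ , τ∈ , π∈τ = All.lookup σ∉ τ∈
    (trans (sym (deleteEntry-extensions (valid (here refl)) π∈σ))
           (deleteEntry-extensions (valid (there τ∈)) π∈τ))

cyclicPartitions-unique : ∀ n → Unique (cyclicPartitions n)
cyclicPartitions-unique zero    = [] ∷ []
cyclicPartitions-unique (suc n) =
  concatMap-extensions-unique (cyclicPartitions n) (cyclicPartitions-unique n) (cyclicPartitions-sound n)

-- Weights of partitions

sumMap : ∀ {A : Set} → (A → ℕ) → List A → ℕ
sumMap f xs = sum (map f xs)

sumMap-++ : ∀ {A : Set} (f : A → ℕ) xs ys → sumMap f (xs ++ ys) ≡ sumMap f xs + sumMap f ys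
sumMap-++ f xs ys = trans (cong sum (LP.map-++ f xs ys)) (sum-++ (map f xs) (map f ys))

sumMap-map : ∀ {A B : Set} (f : B → ℕ) (g : A → B) xs → sumMap f (map g xs) ≡ sumMap (f ∘ g) xs
sumMap-map f g xs = cong sum (sym (LP.map-∘ xs))

sumMap-cong : ∀ {A : Set} {f g : A → ℕ} xs → (∀ {x} → x ∈ xs → f x ≡ g x) → sumMap f xs ≡ sumMap g xs
sumMap-cong []       f≗g = refl
sumMap-cong (x ∷ xs) f≗g = cong₂ _+_ (f≗g (here refl)) (sumMap-cong xs (f≗g ∘ there))

sumMap-const : ∀ {A : Set} {f : A → ℕ} {c} xs → (∀ {x} → x ∈ xs → f x ≡ c) → sumMap f xs ≡ length xs * c
sumMap-const []       _    = refl
sumMap-const (x ∷ xs) f≡c = cong₂ _+_ (f≡c (here refl)) (sumMap-const xs (f≡c ∘ there))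

sumMap-concatMap : ∀ {A B : Set} (f : B → ℕ) (g : A → List B) xs →
                   sumMap f (concatMap g xs) ≡ sumMap (sumMap f ∘ g) xs
sumMap-concatMap f g []       = refl
sumMap-concatMap f g (x ∷ xs) =
  trans (sumMap-++ f (g x) (concatMap g xs)) (cong (_+_ (sumMap f (g x))) (sumMap-concatMap f g xs))

length-filter≡sumMap : ∀ {A : Set} {P : A → Set} (P? : Decidable P) (f : A → ℕ) xs →
  (∀ {x} → x ∈ xs → P x → f x ≡ 1) → (∀ {x} → x ∈ xs → ¬ P x → f x ≡ 0) →
  length (filter P? xs) ≡ sumMap f xs
length-filter≡sumMap P? f []       _   _   = refl
length-filter≡sumMap P? f (x ∷ xs) yes₁ no₀ with P? x
... | yes Px = cong₂ _+_ (sym (yes₁ (here refl) Px)) rest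
  where rest = length-filter≡sumMap P? f xs (yes₁ ∘ there) (no₀ ∘ there)
... | no ¬Px = trans rest (cong (_+ sumMap f xs) (sym (no₀ (here refl) ¬Px)))
  where rest = length-filter≡sumMap P? f xs (yes₁ ∘ there) (no₀ ∘ there)

descentsFrom-< : ∀ {a c} → c < a → ∀ w → descentsFrom a (c ∷ w) ≡ suc (descentsFrom c w)
descentsFrom-< {a} {c} c<a w with c <? a
... | yes _   = refl
... | no c≮a = ⊥-elim (c≮a c<a)

descentsFrom-≮ : ∀ {a c} → ¬ c < a → ∀ w → descentsFrom a (c ∷ w) ≡ descentsFrom c w
descentsFrom-≮ {a} {c} c≮a w with c <? a
... | yes c<a = ⊥-elim (c≮a c<a)
... | no _    = refl

descentsFrom≤length : ∀ a w → descentsFrom a w ≤ length w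
descentsFrom≤length a []      = z≤n
descentsFrom≤length a (b ∷ w) with b <? a
... | yes _ = s≤s (descentsFrom≤length b w)
... | no _  = ℕP.m≤n⇒m≤1+n (descentsFrom≤length b w)

insertAfter : ℕ → List ℕ → List (List ℕ)
insertAfter t []      = []
insertAfter t (a ∷ w) = map (a ∷_) ((t ∷ w) ∷ insertAfter t w)

descentsAfterInsertion : (ℕ → ℕ) → ℕ → ℕ → ℕ
descentsAfterInsertion g ℓ d = suc d * g d + (ℓ ∸ d) * g (suc d)

-- A new maximum inserted after a descent top or at the end keeps the descents; anywhere else it adds one.
insertAfter-descents : ∀ t a u → All (_< t) (a ∷ u) → (g : ℕ → ℕ) →
  sumMap (g ∘ descents) (insertAfter t (a ∷ u)) ≡ descentsAfterInsertion g (length u) (descentsFrom a u)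
insertAfter-descents t a [] (a<t ∷ []) g
  rewrite descentsFrom-≮ (ℕP.<⇒≯ a<t) [] = cong (_+ 0) (sym (ℕP.+-identityʳ (g 0)))
insertAfter-descents t a (c ∷ u) (a<t ∷ c<t ∷ u<t) g = step (c <? a)
  where
  open ≡-Reasoning
  d = descentsFrom c u
  L = (t ∷ u) ∷ insertAfter t u
  first : descentsFrom a (t ∷ c ∷ u) ≡ suc d
  first = trans (descentsFrom-≮ (ℕP.<⇒≯ a<t) (c ∷ u)) (descentsFrom-< c<t u)
  unfold : ∀ (h : ℕ → ℕ) → (∀ w → descentsFrom a (c ∷ w) ≡ h (descentsFrom c w)) →
           sumMap (g ∘ descents) (insertAfter t (a ∷ c ∷ u))
             ≡ g (suc d) + sumMap (g ∘ h ∘ descents) (insertAfter t (c ∷ u))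
  unfold h shift = begin
    sumMap (g ∘ descents) (map (a ∷_) ((t ∷ c ∷ u) ∷ insertAfter t (c ∷ u)))
      ≡⟨ sumMap-map (g ∘ descents) (a ∷_) ((t ∷ c ∷ u) ∷ insertAfter t (c ∷ u)) ⟩
    g (descentsFrom a (t ∷ c ∷ u)) + sumMap (g ∘ descentsFrom a) (map (c ∷_) L)
      ≡⟨ cong₂ _+_ (cong g first) (sumMap-map (g ∘ descentsFrom a) (c ∷_) L) ⟩
    g (suc d) + sumMap (g ∘ descentsFrom a ∘ (c ∷_)) L
      ≡⟨ cong (_+_ (g (suc d))) (sumMap-cong L λ {w} _ → cong g (shift w)) ⟩
    g (suc d) + sumMap (g ∘ h ∘ descentsFrom c) L
      ≡⟨ cong (_+_ (g (suc d))) (sumMap-map (g ∘ h ∘ descents) (c ∷_) L) ⟨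
    g (suc d) + sumMap (g ∘ h ∘ descents) (insertAfter t (c ∷ u))
      ∎
  step : Dec (c < a) → sumMap (g ∘ descents) (insertAfter t (a ∷ c ∷ u))
                         ≡ descentsAfterInsertion g (length (c ∷ u)) (descentsFrom a (c ∷ u))
  step (yes c<a) = begin
    sumMap (g ∘ descents) (insertAfter t (a ∷ c ∷ u))
      ≡⟨ unfold suc (descentsFrom-< c<a) ⟩
    g (suc d) + sumMap (g ∘ suc ∘ descents) (insertAfter t (c ∷ u))
      ≡⟨ cong (_+_ (g (suc d))) (insertAfter-descents t c u (c<t ∷ u<t) (g ∘ suc)) ⟩
    g (suc d) + (suc d * g (suc d) + (length u ∸ d) * g (suc (suc d)))
      ≡⟨ ℕP.+-assoc (g (suc d)) _ _ ⟨
    descentsAfterInsertion g (length (c ∷ u)) (suc d)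
      ≡⟨ cong (descentsAfterInsertion g (length (c ∷ u))) (descentsFrom-< c<a u) ⟨
    descentsAfterInsertion g (length (c ∷ u)) (descentsFrom a (c ∷ u))
      ∎
  step (no c≮a) = begin
    sumMap (g ∘ descents) (insertAfter t (a ∷ c ∷ u))
      ≡⟨ unfold (λ e → e) (descentsFrom-≮ c≮a) ⟩
    g (suc d) + sumMap (g ∘ descents) (insertAfter t (c ∷ u))
      ≡⟨ cong (_+_ (g (suc d))) (insertAfter-descents t c u (c<t ∷ u<t) g) ⟩
    g (suc d) + (suc d * g d + (length u ∸ d) * g (suc d))
      ≡⟨ regroup (g (suc d)) (suc d * g d) (length u ∸ d) ⟩
    suc d * g d + suc (length u ∸ d) * g (suc d)
      ≡⟨ cong (λ k → suc d * g d + k * g (suc d)) (ℕP.+-∸-assoc 1 (descentsFrom≤length c u)) ⟨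
    descentsAfterInsertion g (length (c ∷ u)) d
      ≡⟨ cong (descentsAfterInsertion g (length (c ∷ u))) (descentsFrom-≮ c≮a u) ⟨
    descentsAfterInsertion g (length (c ∷ u)) (descentsFrom a (c ∷ u))
      ∎
    where
    regroup : ∀ x y k → x + (y + k * x) ≡ y + suc k * x
    regroup = solve-∀

openers-insertBlock : ∀ t σ → map openers (insertBlock t σ) ≡ insertAfter t (openers σ)
openers-insertBlock t []      = refl
openers-insertBlock t (b ∷ σ) = cong (_∷_ (opener b ∷ t ∷ openers σ)) (begin
  map openers (map (b ∷_) (insertBlock t σ))           ≡⟨ LP.map-∘ (insertBlock t σ) ⟨
  map (λ π → opener b ∷ openers π) (insertBlock t σ)  ≡⟨ LP.map-∘ (insertBlock t σ) ⟩
  map (opener b ∷_) (map openers (insertBlock t σ))   ≡⟨ cong (map (opener b ∷_)) (openers-insertBlock t σ) ⟩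
  map (opener b ∷_) (insertAfter t (openers σ))       ∎)
  where open ≡-Reasoning

openers-appendToBlock : ∀ t {σ π} → All NonEmpty σ → π ∈ appendToBlock t σ → openers π ≡ openers σ
openers-appendToBlock t {(x ∷ b) ∷ σ} (nonEmpty ∷ _) (here refl) = refl
openers-appendToBlock t {b ∷ σ} (_ ∷ nonEmpties) (there π∈) with ∈-map⁻ (b ∷_) π∈
... | π′ , π′∈ , refl = cong (_∷_ (opener b)) (openers-appendToBlock t nonEmpties π′∈)

openers-< : ∀ {t π} → All NonEmpty π → All (All (_< t)) π → All (_< t) (openers π)
openers-< []               []                 = []
openers-< (nonEmpty ∷ nes) ((x<t ∷ _) ∷ π<t) = x<t ∷ openers-< nes π<t

length-appendToBlock : ∀ t σ → length (appendToBlock t σ) ≡ length σ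
length-appendToBlock t []      = refl
length-appendToBlock t (b ∷ σ) =
  cong suc (trans (LP.length-map (b ∷_) (appendToBlock t σ)) (length-appendToBlock t σ))

descents-openers≤ : ∀ b σ → descents (openers (b ∷ σ)) ≤ length σ
descents-openers≤ b σ =
  subst (descentsFrom (opener b) (openers σ) ≤_) (LP.length-map opener σ) (descentsFrom≤length (opener b) (openers σ))

monomial : Partition → Coeffs
monomial π = mono (suc (descents (openers π))) (length π ∸ suc (descents (openers π)))

Dᶜ-monomial : ∀ {d ℓ} → d ≤ ℓ → ∀ i j → Dᶜ (mono (suc d) (ℓ ∸ d)) i j
  ≡ suc ℓ * mono (suc d) (ℓ ∸ d) i j + descentsAfterInsertion (λ e → mono (suc e) (suc ℓ ∸ e) i j) ℓ d
Dᶜ-monomial {d} {ℓ} d≤ℓ i j = begin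
  Dᶜ (mono (suc d) (ℓ ∸ d)) i j
    ≡⟨ Dᶜ-mono (suc d) (ℓ ∸ d) i j ⟩
  (suc d + (ℓ ∸ d)) * m (ℓ ∸ d) + suc d * m (suc (ℓ ∸ d)) + (ℓ ∸ d) * m′
    ≡⟨ cong₂ (λ k e → k * m (ℓ ∸ d) + suc d * m e + (ℓ ∸ d) * m′)
             (cong suc (ℕP.m+[n∸m]≡n d≤ℓ)) (sym (ℕP.+-∸-assoc 1 d≤ℓ)) ⟩
  suc ℓ * m (ℓ ∸ d) + suc d * m (suc ℓ ∸ d) + (ℓ ∸ d) * m′
    ≡⟨ ℕP.+-assoc (suc ℓ * m (ℓ ∸ d)) _ _ ⟩
  suc ℓ * m (ℓ ∸ d) + (suc d * m (suc ℓ ∸ d) + (ℓ ∸ d) * m′)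
    ∎
  where
  open ≡-Reasoning
  m : ℕ → ℕ
  m k = mono (suc d) k i j
  m′ = mono (suc (suc d)) (ℓ ∸ d) i j

extensions-monomial : ∀ {m σ} → CycOrdPartition m σ → ∀ i j →
                      sumMap (λ π → monomial π i j) (extensions (suc m) σ) ≡ Dᶜ (monomial σ) i j
extensions-monomial {m} {[]} (_ , _ , _ , ()) i j
extensions-monomial {m} {b ∷ σ} v@(nonEmpties , _ , _ , _) i j = begin
  sumMap f (appendToBlock t (b ∷ σ) ++ insertBlock t (b ∷ σ))
    ≡⟨ sumMap-++ f (appendToBlock t (b ∷ σ)) (insertBlock t (b ∷ σ)) ⟩
  sumMap f (appendToBlock t (b ∷ σ)) + sumMap f (insertBlock t (b ∷ σ))
    ≡⟨ cong₂ _+_ appended inserted ⟩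
  suc ℓ * monomial (b ∷ σ) i j + descentsAfterInsertion g ℓ d
    ≡⟨ Dᶜ-monomial d≤ℓ i j ⟨
  Dᶜ (monomial (b ∷ σ)) i j
    ∎
  where
  open ≡-Reasoning
  t = suc m
  ℓ = length σ
  d = descents (openers (b ∷ σ))
  f : Partition → ℕ
  f π = monomial π i j
  g : ℕ → ℕ
  g e = mono (suc e) (suc ℓ ∸ e) i j
  d≤ℓ : d ≤ ℓ
  d≤ℓ = descents-openers≤ b σ
  appended : sumMap f (appendToBlock t (b ∷ σ)) ≡ suc ℓ * monomial (b ∷ σ) i j
  appended = trans (sumMap-const (appendToBlock t (b ∷ σ)) λ π∈ →
                      cong₂ (λ k w → mono (suc (descents w)) (k ∸ suc (descents w)) i j)
                            (appendToBlock-length t (b ∷ σ) π∈) (openers-appendToBlock t nonEmpties π∈))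
                   (cong (_* monomial (b ∷ σ) i j) (length-appendToBlock t (b ∷ σ)))
  inserted : sumMap f (insertBlock t (b ∷ σ)) ≡ descentsAfterInsertion g ℓ d
  inserted = begin
    sumMap f (insertBlock t (b ∷ σ))
      ≡⟨ sumMap-cong (insertBlock t (b ∷ σ)) (λ {π} π∈ →
           cong (λ k → mono (suc (descents (openers π))) (k ∸ suc (descents (openers π))) i j)
                (insertBlock-length t (b ∷ σ) π∈)) ⟩
    sumMap (g ∘ descents ∘ openers) (insertBlock t (b ∷ σ))
      ≡⟨ sumMap-map (g ∘ descents) openers (insertBlock t (b ∷ σ)) ⟨
    sumMap (g ∘ descents) (map openers (insertBlock t (b ∷ σ)))
      ≡⟨ cong (sumMap (g ∘ descents)) (openers-insertBlock t (b ∷ σ)) ⟩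
    sumMap (g ∘ descents) (insertAfter t (openers (b ∷ σ)))
      ≡⟨ insertAfter-descents t (opener b) (openers σ) (openers-< nonEmpties (entries-< v)) g ⟩
    descentsAfterInsertion g (length (openers σ)) d
      ≡⟨ cong (λ k → descentsAfterInsertion g k d) (LP.length-map opener σ) ⟩
    descentsAfterInsertion g ℓ d
      ∎

generating : List Partition → Coeffs
generating πs i j = sumMap (λ π → monomial π i j) πs

Dᶜ-zero : ∀ i j → Dᶜ (λ _ _ → 0) i j ≡ 0
Dᶜ-zero i j = cong₂ _+_ (cong₂ _+_ (ℕP.*-zeroʳ i) (mulY-θx j))
                        (cong₂ _+_ (ℕP.*-zeroʳ j) (mulX-θy i))
  where
  mulY-θx : ∀ j → mulY (θx λ _ _ → 0) i j ≡ 0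
  mulY-θx zero    = refl
  mulY-θx (suc j) = ℕP.*-zeroʳ i
  mulX-θy : ∀ i → mulX (θy λ _ _ → 0) i j ≡ 0
  mulX-θy zero    = refl
  mulX-θy (suc i) = ℕP.*-zeroʳ j

Dᶜ-generating : ∀ πs i j → Dᶜ (generating πs) i j ≡ sumMap (λ π → Dᶜ (monomial π) i j) πs
Dᶜ-generating []       i j = Dᶜ-zero i j
Dᶜ-generating (π ∷ πs) i j =
  trans (IsLinear.⊞-hom Dᶜ-isLinear (monomial π) (generating πs) i j)
        (cong (_+_ (Dᶜ (monomial π) i j)) (Dᶜ-generating πs i j))

ncoeff-iterD : ∀ n → ncoeff (iterD-constantFree n) ≗₂ generating (cyclicPartitions n)
ncoeff-iterD zero    i j = sym (ℕP.+-identityʳ (mono 1 0 i j))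
ncoeff-iterD (suc n) i j = begin
  ncoeff (D-constantFree (iterD-constantFree n)) i j
    ≡⟨ ncoeff-D (iterD-constantFree n) i j ⟩
  Dᶜ (ncoeff (iterD-constantFree n)) i j
    ≡⟨ IsLinear.≗-cong Dᶜ-isLinear (ncoeff-iterD n) i j ⟩
  Dᶜ (generating (cyclicPartitions n)) i j
    ≡⟨ Dᶜ-generating (cyclicPartitions n) i j ⟩
  sumMap (λ σ → Dᶜ (monomial σ) i j) (cyclicPartitions n)
    ≡⟨ sumMap-cong (cyclicPartitions n) (λ σ∈ → extensions-monomial (cyclicPartitions-sound n σ∈) i j) ⟨
  sumMap (λ σ → generating (extensions (suc (suc n)) σ) i j) (cyclicPartitions n)
    ≡⟨ sumMap-concatMap (λ π → monomial π i j) (extensions (suc (suc n))) (cyclicPartitions n) ⟨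
  generating (cyclicPartitions (suc n)) i j
    ∎
  where open ≡-Reasoning

BlocksDescents : ℕ → ℕ → Partition → Set
BlocksDescents k d π = length π ≡ k × descents (openers π) ≡ d

blocksDescents? : ∀ k d → Decidable (BlocksDescents k d)
blocksDescents? k d π = (length π ℕP.≟ k) ×-dec (descents (openers π) ℕP.≟ d)

descents<length : ∀ {m π} → CycOrdPartition m π → descents (openers π) < length π
descents<length {π = []}    (_ , _ , _ , ())
descents<length {π = b ∷ σ} _ = s≤s (descents-openers≤ b σ)

monomial-≡1 : ∀ {π i j} → BlocksDescents (suc i + j) i π → monomial π (suc i) j ≡ 1
monomial-≡1 {π} {i} {j} (ℓ≡ , d≡) rewrite ℓ≡ | d≡ | ℕP.m+n∸m≡n (suc i) j | δ-refl i | δ-refl j = refl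

monomial-≡0 : ∀ {π i j} → descents (openers π) < length π → ¬ BlocksDescents (suc i + j) i π →
              monomial π (suc i) j ≡ 0
monomial-≡0 {π} {i} {j} d<ℓ ¬shape with descents (openers π) ℕP.≟ i
... | no d≢i  rewrite δ-≢ d≢i = refl
... | yes refl = trans (cong (δ i i *_) (δ-≢ ℓ∸≢j)) (ℕP.*-zeroʳ (δ i i))
  where
  ℓ∸≢j : length π ∸ suc i ≢ j
  ℓ∸≢j eq = ¬shape (trans (sym (ℕP.m+[n∸m]≡n d<ℓ)) (cong (_+_ (suc i)) eq) , refl)

generating≡count : ∀ n i j →
  generating (cyclicPartitions n) (suc i) j ≡ length (filter (blocksDescents? (suc i + j) i) (cyclicPartitions n))
generating≡count n i j = sym (length-filter≡sumMap (blocksDescents? (suc i + j) i) (λ π → monomial π (suc i) j)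
  (cyclicPartitions n) (λ {π} _ → monomial-≡1 {π})
  (λ {π} π∈ → monomial-≡0 {π} (descents<length (cyclicPartitions-sound n π∈))))

cyclicPartitions-∈ : ∀ n {π} → π ∈ cyclicPartitions n ⇔ CycOrdPartition (n + 1) π
cyclicPartitions-∈ n {π} = mk⇔ (subst (λ m → CycOrdPartition m π) suc≡+1 ∘ cyclicPartitions-sound n)
                                (cyclicPartitions-complete n ∘ subst (λ m → CycOrdPartition m π) (sym suc≡+1))
  where
  suc≡+1 : suc n ≡ n + 1
  suc≡+1 = ℕP.+-comm 1 n

corollary1 : (n i j : ℕ) → 1 ≤ n → 1 ≤ i → 1 ≤ j →
    Σ (List (List (List ℕ))) (λ L →
      Unique L
      × ((π : List (List ℕ)) →
           (π ∈ L) ⇔ (CycOrdPartition (n + 1) π × length π ≡ i + j × descents (openers π) ≡ i ∸ 1))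
      × coeff (iterD n X) i j ≡ ((+ length L) / 1))
corollary1 n (suc i) j _ _ _ =
  filter shape? (cyclicPartitions n) ,
  UniqueP.filter⁺ shape? (cyclicPartitions-unique n) ,
  (λ π → mk⇔ (λ π∈ → let π∈ps , hasShape = ∈-filter⁻ shape? π∈
                     in to (cyclicPartitions-∈ n) π∈ps , hasShape)
             (λ (v , hasShape) → ∈-filter⁺ shape? (from (cyclicPartitions-∈ n) v) hasShape)) ,
  (begin
    coeff (iterD n X) (suc i) j                       ≡⟨ coeff≡⟦ncoeff⟧ (iterD-constantFree n) (suc i) j ⟩
    ⟦ ncoeff (iterD-constantFree n) (suc i) j ⟧       ≡⟨ cong ⟦_⟧ (ncoeff-iterD n (suc i) j) ⟩
    ⟦ generating (cyclicPartitions n) (suc i) j ⟧     ≡⟨ cong ⟦_⟧ (generating≡count n i j) ⟩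
    ⟦ length (filter shape? (cyclicPartitions n)) ⟧   ∎)
  where
  open ≡-Reasoning
  open Equivalence
  shape? = blocksDescents? (suc i + j) i
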